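{- Let $p$ be a prime and let $n\ge0$, $r\ge1$ be integers. Then $$\int_{\mathbb{Z}_p}\binom{x}{n}^r\,d\mu_1(x)=\sum_{k=0}^{nr}\frac{(-1)^k}{k+1}\sum_{j=0}^{k}(-1)^j\binom{k}{j}\binom{k-j}{n}^r.$$
   Context: The Volkenborn integral of a polynomial function $f:\mathbb{Z}_p\to\mathbb{Q}_p$ is $\int_{\mathbb{Z}_p}f(x)\,d\mu_1(x)=\lim_{N\to\infty}p^{ -N}\sum_{x=0}^{p^N-1}f(x)$. $\binom{y}{n}=\frac{y(y-1)\cdots(y-n+1)}{n!}$. -}

module Defs where

open import Data.Nat as ℕ using (ℕ; zero; suc; _≤_; _∸_; NonZero)
open import Data.Nat.Properties using (m^n≢0)
open import Data.Nat.Divisibility using (_∣_)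
open import Data.Nat.Primality using (Prime; prime⇒nonZero)
open import Data.Nat.Combinatorics using (_C_)
open import Data.Integer using (ℤ; +_; ∣_∣)
open import Data.Rational using (ℚ; 0ℚ; 1ℚ; _+_; _-_; _*_; -_; _/_; ↥_; ↧ₙ_)
open import Data.Product using (_×_; ∃)
open import Relation.Nullary using (¬_)

ℕ→ℚ : ℕ → ℚ
ℕ→ℚ n = + n / 1

Σ< : ℕ → (ℕ → ℚ) → ℚ
Σ< zero    f = 0ℚ
Σ< (suc n) f = Σ< n f + f n

sgn : ℕ → ℚ
sgn zero    = 1ℚ
sgn (suc k) = - sgn k

_^ℚ_ : ℚ → ℕ → ℚ
q ^ℚ zero  = 1ℚ
q ^ℚ suc r = q * (q ^ℚ r)

-- p-adic closeness: v_p(q) ≥ e  (for e ≥ 0): in lowest terms,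
-- p^e divides the numerator and p does not divide the denominator.
-- (q = 0 has numerator 0 and denominator 1, so it satisfies this for every e.)
PadicSmall : (p e : ℕ) → ℚ → Set
PadicSmall p e q = (p ℕ.^ e) ∣ ∣ ↥ q ∣ × ¬ (p ∣ ↧ₙ q)

PadicLimit : (p : ℕ) → (ℕ → ℚ) → ℚ → Set
PadicLimit p a L = ∀ (e : ℕ) → ∃ λ N₀ → ∀ N → N₀ ≤ N → PadicSmall p e (a N - L)

volkenbornSum : (p : ℕ) → Prime p → (ℕ → ℚ) → ℕ → ℚ
volkenbornSum p pp f N = (+ 1 / (p ℕ.^ N)) * Σ< (p ℕ.^ N) f
  where instance
    _ = prime⇒nonZero pp
    _ = m^n≢0 p N

-- "∫_{Z_p} f dμ₁ = L" : the Volkenborn limit exists in ℚ_p and equals L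
VolkenbornIntegral≡ : (p : ℕ) → Prime p → (ℕ → ℚ) → ℚ → Set
VolkenbornIntegral≡ p pp f L = PadicLimit p (volkenbornSum p pp f) L

rhs13 : ℕ → ℕ → ℚ
rhs13 n r = Σ< (suc (n ℕ.* r)) λ k →
  (sgn k * (+ 1 / suc k)) *
  Σ< (suc k) (λ j → sgn j * ℕ→ℚ (k C j) * (ℕ→ℚ ((k ∸ j) C n) ^ℚ r))

-- f(x) = (x C n)^r is a polynomial of degree nr, so Newton's
-- forward-difference series gives  Σ_{x<M} f(x) = Σ_{k≤nr} (M C (k+1)) Δ^k f(0),
-- and Δ^k f(0) is exactly the inner alternating sum of the right-hand side.
-- Hence for M = p^N the Riemann sum minus the claimed value is
-- Σ_k ((M C (k+1))/M - (-1)^k/(k+1)) Δ^k f(0).  Multiplying the bracket by (k+1)!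
-- gives k! ((M-1) C k) - (-1)^k k!, divisible by M since M - 1 ≡ -1 (mod M);
-- as Δ^k f(0) is an integer, the error has p-adic valuation at least
-- N - v_p((nr+1)!), which tends to infinity.

module Submission where

open import Defs
open import Data.Nat using (ℕ; _≤_)
open import Data.Nat.Primality using (Prime)
open import Data.Nat.Combinatorics using (_C_)

open import Data.Empty using (⊥-elim)
open import Data.Integer as ℤ using (ℤ; +_; -[1+_]; ∣_∣)
import Data.Integer.Divisibility.Signed as ZS
import Data.Integer.Properties as ℤP
open import Data.Integer.Tactic.RingSolver using () renaming (solve-∀ to solve-∀ℤ)
open import Data.Nat as ℕ using (zero; suc; _∸_; _<_; _!; _⊔_; NonZero)
import Data.Nat.Combinatorics as NC
open import Data.Nat.Coprimality as Coprimality using (Coprime)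
open import Data.Nat.Divisibility as ND using (_∣_; divides; _∣?_)
open import Data.Nat.Primality using (euclidsLemma; prime⇒nonZero; prime⇒nonTrivial)
import Data.Nat.Properties as ℕP
open import Data.Nat.Tactic.RingSolver using () renaming (solve-∀ to solve-∀ℕ)
open import Data.Product using (_×_; _,_; ∃; ∃₂)
open import Data.Rational using (ℚ; mkℚ; 0ℚ; 1ℚ; _+_; _-_; _*_; -_; _/_; toℚᵘ)
import Data.Rational.Properties as ℚP
open import Data.Rational.Solver using (module +-*-Solver)
open +-*-Solver using (solve; _:=_; _:+_; _:*_; _:-_; :-_; con)
open import Data.Rational.Unnormalised as U using (ℚᵘ; mkℚᵘ; _≃_; *≡*)
import Data.Rational.Unnormalised.Properties as UP
open import Data.Sum using (inj₁; inj₂)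
open import Relation.Binary.PropositionalEquality
open import Relation.Nullary using (¬_; yes; no)

ℤ→ℚ : ℤ → ℚ
ℤ→ℚ z = z / 1

toℚᵘ-ℤ→ℚ : ∀ z → toℚᵘ (ℤ→ℚ z) ≃ mkℚᵘ z 0
toℚᵘ-ℤ→ℚ z = ℚP.toℚᵘ-fromℚᵘ (mkℚᵘ z 0)

ℤ→ℚ-+ : ∀ z w → ℤ→ℚ (z ℤ.+ w) ≡ ℤ→ℚ z + ℤ→ℚ w
ℤ→ℚ-+ z w = ℚP.toℚᵘ-injective (begin
  toℚᵘ (ℤ→ℚ (z ℤ.+ w))           ≈⟨ toℚᵘ-ℤ→ℚ (z ℤ.+ w) ⟩
  mkℚᵘ (z ℤ.+ w) 0                ≈⟨ *≡* (+-over-1 z w) ⟩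
  mkℚᵘ z 0 U.+ mkℚᵘ w 0           ≈⟨ UP.+-cong (toℚᵘ-ℤ→ℚ z) (toℚᵘ-ℤ→ℚ w) ⟨
  toℚᵘ (ℤ→ℚ z) U.+ toℚᵘ (ℤ→ℚ w)   ≈⟨ ℚP.toℚᵘ-homo-+ (ℤ→ℚ z) (ℤ→ℚ w) ⟨
  toℚᵘ (ℤ→ℚ z + ℤ→ℚ w)            ∎)
  where
  open UP.≃-Reasoning
  +-over-1 : ∀ z w → (z ℤ.+ w) ℤ.* + 1 ≡ (z ℤ.* + 1 ℤ.+ w ℤ.* + 1) ℤ.* + 1
  +-over-1 = solve-∀ℤ

ℤ→ℚ-* : ∀ z w → ℤ→ℚ (z ℤ.* w) ≡ ℤ→ℚ z * ℤ→ℚ w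
ℤ→ℚ-* z w = ℚP.toℚᵘ-injective (begin
  toℚᵘ (ℤ→ℚ (z ℤ.* w))           ≈⟨ toℚᵘ-ℤ→ℚ (z ℤ.* w) ⟩
  mkℚᵘ z 0 U.* mkℚᵘ w 0           ≈⟨ UP.*-cong (toℚᵘ-ℤ→ℚ z) (toℚᵘ-ℤ→ℚ w) ⟨
  toℚᵘ (ℤ→ℚ z) U.* toℚᵘ (ℤ→ℚ w)   ≈⟨ ℚP.toℚᵘ-homo-* (ℤ→ℚ z) (ℤ→ℚ w) ⟨
  toℚᵘ (ℤ→ℚ z * ℤ→ℚ w)            ∎)
  where open UP.≃-Reasoning

ℤ→ℚ-neg : ∀ z → ℤ→ℚ (ℤ.- z) ≡ - ℤ→ℚ z
ℤ→ℚ-neg z = ℚP.toℚᵘ-injective (begin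
  toℚᵘ (ℤ→ℚ (ℤ.- z))  ≈⟨ toℚᵘ-ℤ→ℚ (ℤ.- z) ⟩
  U.- mkℚᵘ z 0         ≈⟨ UP.-‿cong (toℚᵘ-ℤ→ℚ z) ⟨
  U.- toℚᵘ (ℤ→ℚ z)     ≈⟨ ℚP.toℚᵘ-homo‿- (ℤ→ℚ z) ⟨
  toℚᵘ (- ℤ→ℚ z)       ∎)
  where open UP.≃-Reasoning

ℕ→ℚ-+ : ∀ a b → ℕ→ℚ (a ℕ.+ b) ≡ ℕ→ℚ a + ℕ→ℚ b
ℕ→ℚ-+ a b = ℤ→ℚ-+ (+ a) (+ b)

ℕ→ℚ-* : ∀ a b → ℕ→ℚ (a ℕ.* b) ≡ ℕ→ℚ a * ℕ→ℚ b
ℕ→ℚ-* a b = trans (cong ℤ→ℚ (ℤP.pos-* a b)) (ℤ→ℚ-* (+ a) (+ b))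

ℕ→ℚ-pascal : ∀ m k → ℕ→ℚ (suc m C suc k) ≡ ℕ→ℚ (m C k) + ℕ→ℚ (m C suc k)
ℕ→ℚ-pascal m k =
  trans (cong ℕ→ℚ (sym (NC.nCk+nC[k+1]≡[n+1]C[k+1] m k))) (ℕ→ℚ-+ (m C k) (m C suc k))

sgnℤ : ℕ → ℤ
sgnℤ zero    = + 1
sgnℤ (suc k) = ℤ.- sgnℤ k

sgn≡ℤ→ℚ-sgnℤ : ∀ k → sgn k ≡ ℤ→ℚ (sgnℤ k)
sgn≡ℤ→ℚ-sgnℤ zero    = refl
sgn≡ℤ→ℚ-sgnℤ (suc k) = trans (cong -_ (sgn≡ℤ→ℚ-sgnℤ k)) (sym (ℤ→ℚ-neg (sgnℤ k)))

Σ<-cong-< : ∀ n {f g : ℕ → ℚ} → (∀ i → i < n → f i ≡ g i) → Σ< n f ≡ Σ< n g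
Σ<-cong-< zero    eq = refl
Σ<-cong-< (suc n) eq =
  cong₂ _+_ (Σ<-cong-< n (λ i i<n → eq i (ℕP.m<n⇒m<1+n i<n))) (eq n ℕP.≤-refl)

Σ<-cong : ∀ n {f g : ℕ → ℚ} → (∀ i → f i ≡ g i) → Σ< n f ≡ Σ< n g
Σ<-cong n eq = Σ<-cong-< n (λ i _ → eq i)

Σ<-+ : ∀ n (f g : ℕ → ℚ) → Σ< n (λ i → f i + g i) ≡ Σ< n f + Σ< n g
Σ<-+ zero    f g = refl
Σ<-+ (suc n) f g =
  trans (cong (_+ (f n + g n)) (Σ<-+ n f g)) (interchange (Σ< n f) (Σ< n g) (f n) (g n))
  where
  interchange : ∀ a b c d → (a + b) + (c + d) ≡ (a + c) + (b + d)
  interchange = solve 4 (λ a b c d → (a :+ b) :+ (c :+ d) := (a :+ c) :+ (b :+ d)) refl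

Σ<-neg : ∀ n (f : ℕ → ℚ) → Σ< n (λ i → - f i) ≡ - Σ< n f
Σ<-neg zero    f = refl
Σ<-neg (suc n) f =
  trans (cong (_+ (- f n)) (Σ<-neg n f)) (sym (ℚP.neg-distrib-+ (Σ< n f) (f n)))

Σ<-- : ∀ n (f g : ℕ → ℚ) → Σ< n (λ i → f i - g i) ≡ Σ< n f - Σ< n g
Σ<-- n f g = trans (Σ<-+ n f (λ i → - g i)) (cong (_+_ (Σ< n f)) (Σ<-neg n g))

*-distribˡ-Σ< : ∀ n c (f : ℕ → ℚ) → c * Σ< n f ≡ Σ< n (λ i → c * f i)
*-distribˡ-Σ< zero    c f = ℚP.*-zeroʳ c
*-distribˡ-Σ< (suc n) c f =
  trans (ℚP.*-distribˡ-+ c (Σ< n f) (f n)) (cong (_+ (c * f n)) (*-distribˡ-Σ< n c f))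

Σ<-0 : ∀ n → Σ< n (λ _ → 0ℚ) ≡ 0ℚ
Σ<-0 zero    = refl
Σ<-0 (suc n) = cong (_+ 0ℚ) (Σ<-0 n)

Σ<-head : ∀ n (f : ℕ → ℚ) → Σ< (suc n) f ≡ f 0 + Σ< n (λ i → f (suc i))
Σ<-head zero    f = trans (ℚP.+-identityˡ (f 0)) (sym (ℚP.+-identityʳ (f 0)))
Σ<-head (suc n) f =
  trans (cong (_+ f (suc n)) (Σ<-head n f)) (ℚP.+-assoc (f 0) (Σ< n (λ i → f (suc i))) (f (suc n)))

Δ : (ℕ → ℚ) → ℕ → ℚ
Δ f x = f (suc x) - f x

Δ^ : ℕ → (ℕ → ℚ) → ℕ → ℚ
Δ^ zero    f = f
Δ^ (suc k) f = Δ^ k (Δ f)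

DegreeAtMost : ℕ → (ℕ → ℚ) → Set
DegreeAtMost d f = ∀ x → Δ^ (suc d) f x ≡ 0ℚ

Δ-cong : ∀ {f g : ℕ → ℚ} → (∀ x → f x ≡ g x) → ∀ x → Δ f x ≡ Δ g x
Δ-cong eq x = cong₂ _-_ (eq (suc x)) (eq x)

Δ^-cong : ∀ k {f g : ℕ → ℚ} → (∀ x → f x ≡ g x) → ∀ x → Δ^ k f x ≡ Δ^ k g x
Δ^-cong zero    eq = eq
Δ^-cong (suc k) eq = Δ^-cong k (Δ-cong eq)

Δ-+ : ∀ f g x → Δ (λ y → f y + g y) x ≡ Δ f x + Δ g x
Δ-+ f g x = swap-differences (f (suc x)) (f x) (g (suc x)) (g x)
  where
  swap-differences : ∀ a b c d → (a + c) - (b + d) ≡ (a - b) + (c - d)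
  swap-differences = solve 4 (λ a b c d → (a :+ c) :- (b :+ d) := (a :- b) :+ (c :- d)) refl

Δ-* : ∀ f g x → Δ (λ y → f y * g y) x ≡ Δ f x * g (suc x) + f x * Δ g x
Δ-* f g x = product-rule (f (suc x)) (f x) (g (suc x)) (g x)
  where
  product-rule : ∀ a b c d → a * c - b * d ≡ (a - b) * c + b * (c - d)
  product-rule = solve 4 (λ a b c d → a :* c :- b :* d := (a :- b) :* c :+ b :* (c :- d)) refl

degree-cong : ∀ d {f g} → (∀ x → f x ≡ g x) → DegreeAtMost d f → DegreeAtMost d g
degree-cong d eq deg x = trans (sym (Δ^-cong (suc d) eq x)) (deg x)

degree-suc : ∀ d f → DegreeAtMost d f → DegreeAtMost (suc d) f
degree-suc zero    f deg x = cong₂ _-_ (deg (suc x)) (deg x)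
degree-suc (suc d) f deg   = degree-suc d (Δ f) deg

degree-shift : ∀ d f → DegreeAtMost d f → DegreeAtMost d (λ x → f (suc x))
degree-shift zero    f deg x = deg (suc x)
degree-shift (suc d) f deg   = degree-shift d (Δ f) deg

degree-+ : ∀ d f g → DegreeAtMost d f → DegreeAtMost d g →
           DegreeAtMost d (λ x → f x + g x)
degree-+ zero    f g degf degg x =
  trans (Δ-+ f g x) (trans (cong₂ _+_ (degf x) (degg x)) (ℚP.+-identityˡ 0ℚ))
degree-+ (suc d) f g degf degg =
  degree-cong d (λ x → sym (Δ-+ f g x)) (degree-+ d (Δ f) (Δ g) degf degg)

degree-* : ∀ a b f g → DegreeAtMost a f → DegreeAtMost b g →
           DegreeAtMost (a ℕ.+ b) (λ x → f x * g x)
degree-* zero zero f g degf degg x = begin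
  Δ (λ y → f y * g y) x                  ≡⟨ Δ-* f g x ⟩
  Δ f x * g (suc x) + f x * Δ g x        ≡⟨ cong₂ (λ u v → u * g (suc x) + f x * v) (degf x) (degg x) ⟩
  0ℚ * g (suc x) + f x * 0ℚ              ≡⟨ annihilate (g (suc x)) (f x) ⟩
  0ℚ                                     ∎
  where
  open ≡-Reasoning
  annihilate : ∀ a b → 0ℚ * a + b * 0ℚ ≡ 0ℚ
  annihilate = solve 2 (λ a b → con 0ℚ :* a :+ b :* con 0ℚ := con 0ℚ) refl
degree-* zero (suc b) f g degf degg =
  degree-cong b (λ x → sym (begin
    Δ (λ y → f y * g y) x                ≡⟨ Δ-* f g x ⟩
    Δ f x * g (suc x) + f x * Δ g x      ≡⟨ cong (λ u → u * g (suc x) + f x * Δ g x) (degf x) ⟩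
    0ℚ * g (suc x) + f x * Δ g x         ≡⟨ drop-left (g (suc x)) (f x * Δ g x) ⟩
    f x * Δ g x                          ∎))
    (degree-* zero b f (Δ g) degf degg)
  where
  open ≡-Reasoning
  drop-left : ∀ a b → 0ℚ * a + b ≡ b
  drop-left = solve 2 (λ a b → con 0ℚ :* a :+ b := b) refl
degree-* (suc a) zero f g degf degg =
  degree-cong (a ℕ.+ 0) (λ x → sym (begin
    Δ (λ y → f y * g y) x                ≡⟨ Δ-* f g x ⟩
    Δ f x * g (suc x) + f x * Δ g x      ≡⟨ cong (λ v → Δ f x * g (suc x) + f x * v) (degg x) ⟩
    Δ f x * g (suc x) + f x * 0ℚ         ≡⟨ drop-right (Δ f x * g (suc x)) (f x) ⟩
    Δ f x * g (suc x)                    ∎))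
    (degree-* a zero (Δ f) (λ x → g (suc x)) degf (degree-shift zero g degg))
  where
  open ≡-Reasoning
  drop-right : ∀ a b → a + b * 0ℚ ≡ a
  drop-right = solve 2 (λ a b → a :+ b :* con 0ℚ := a) refl
degree-* (suc a) (suc b) f g degf degg =
  degree-cong (a ℕ.+ suc b) (λ x → sym (Δ-* f g x))
    (degree-+ (a ℕ.+ suc b) (λ x → Δ f x * g (suc x)) (λ x → f x * Δ g x)
      (degree-* a (suc b) (Δ f) (λ x → g (suc x)) degf (degree-shift (suc b) g degg))
      (subst (λ e → DegreeAtMost e (λ x → f x * Δ g x)) (sym (ℕP.+-suc a b))
        (degree-* (suc a) b f (Δ g) degf degg)))

degree-^ℚ : ∀ d r f → DegreeAtMost d f → DegreeAtMost (d ℕ.* r) (λ x → f x ^ℚ r)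
degree-^ℚ d zero    f deg =
  subst (λ e → DegreeAtMost e (λ _ → 1ℚ)) (sym (ℕP.*-zeroʳ d)) (λ _ → refl)
degree-^ℚ d (suc r) f deg =
  subst (λ e → DegreeAtMost e (λ x → f x ^ℚ suc r)) (sym (ℕP.*-suc d r))
    (degree-* d (d ℕ.* r) f (λ x → f x ^ℚ r) deg (degree-^ℚ d r f deg))

degree-C : ∀ n → DegreeAtMost n (λ x → ℕ→ℚ (x C n))
degree-C zero    x = refl
degree-C (suc n) = degree-cong n (λ x → sym (begin
    ℕ→ℚ (suc x C suc n) - ℕ→ℚ (x C suc n)                   ≡⟨ cong (_- ℕ→ℚ (x C suc n)) (ℕ→ℚ-pascal x n) ⟩
    (ℕ→ℚ (x C n) + ℕ→ℚ (x C suc n)) - ℕ→ℚ (x C suc n)      ≡⟨ add-sub (ℕ→ℚ (x C n)) (ℕ→ℚ (x C suc n)) ⟩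
    ℕ→ℚ (x C n)                                             ∎))
  (degree-C n)
  where
  open ≡-Reasoning
  add-sub : ∀ a b → (a + b) - b ≡ a
  add-sub = solve 2 (λ a b → (a :+ b) :- b := a) refl

-- Newton's forward-difference series

Σ<-pascal : ∀ D m (a : ℕ → ℚ) →
  Σ< (suc D) (λ k → ℕ→ℚ (suc m C k) * a k)
    ≡ Σ< (suc D) (λ k → ℕ→ℚ (m C k) * a k) + Σ< D (λ k → ℕ→ℚ (m C k) * a (suc k))
Σ<-pascal D m a = begin
  Σ< (suc D) (λ k → ℕ→ℚ (suc m C k) * a k)
    ≡⟨ Σ<-head D (λ k → ℕ→ℚ (suc m C k) * a k) ⟩
  a₀ + Σ< D (λ i → ℕ→ℚ (suc m C suc i) * a (suc i))
    ≡⟨ cong (_+_ a₀) (Σ<-cong D split) ⟩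
  a₀ + Σ< D (λ i → ℕ→ℚ (m C i) * a (suc i) + ℕ→ℚ (m C suc i) * a (suc i))
    ≡⟨ cong (_+_ a₀) (Σ<-+ D _ _) ⟩
  a₀ + (S + T)
    ≡⟨ rearrange a₀ S T ⟩
  (a₀ + T) + S
    ≡⟨ cong (_+ S) (Σ<-head D (λ k → ℕ→ℚ (m C k) * a k)) ⟨
  Σ< (suc D) (λ k → ℕ→ℚ (m C k) * a k) + S
    ∎
  where
  open ≡-Reasoning
  a₀ = ℕ→ℚ 1 * a 0
  S = Σ< D (λ i → ℕ→ℚ (m C i) * a (suc i))
  T = Σ< D (λ i → ℕ→ℚ (m C suc i) * a (suc i))
  split : ∀ i → ℕ→ℚ (suc m C suc i) * a (suc i)
              ≡ ℕ→ℚ (m C i) * a (suc i) + ℕ→ℚ (m C suc i) * a (suc i)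
  split i = trans (cong (_* a (suc i)) (ℕ→ℚ-pascal m i)) (ℚP.*-distribʳ-+ (a (suc i)) (ℕ→ℚ (m C i)) (ℕ→ℚ (m C suc i)))
  rearrange : ∀ a s t → a + (s + t) ≡ (a + t) + s
  rearrange = solve 3 (λ a s t → a :+ (s :+ t) := (a :+ t) :+ s) refl

newton : ∀ D f → DegreeAtMost D f → ∀ m →
  f m ≡ Σ< (suc D) (λ k → ℕ→ℚ (m C k) * Δ^ k f 0)
newton D f deg zero = sym (begin
  Σ< (suc D) (λ k → ℕ→ℚ (0 C k) * Δ^ k f 0)
    ≡⟨ Σ<-head D (λ k → ℕ→ℚ (0 C k) * Δ^ k f 0) ⟩
  1ℚ * f 0 + Σ< D (λ i → 0ℚ * Δ^ (suc i) f 0)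
    ≡⟨ cong₂ _+_ (ℚP.*-identityˡ (f 0)) (trans (Σ<-cong D (λ i → ℚP.*-zeroˡ (Δ^ (suc i) f 0))) (Σ<-0 D)) ⟩
  f 0 + 0ℚ
    ≡⟨ ℚP.+-identityʳ (f 0) ⟩
  f 0
    ∎)
  where open ≡-Reasoning
newton D f deg (suc m) = begin
  f (suc m)
    ≡⟨ add-difference (f m) (f (suc m)) ⟩
  f m + Δ f m
    ≡⟨ cong₂ _+_ (newton D f deg m) Δf-series ⟩
  Σ< (suc D) (λ k → ℕ→ℚ (m C k) * a k) + Σ< D (λ k → ℕ→ℚ (m C k) * a (suc k))
    ≡⟨ Σ<-pascal D m a ⟨
  Σ< (suc D) (λ k → ℕ→ℚ (suc m C k) * a k)
    ∎
  where
  open ≡-Reasoning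
  a : ℕ → ℚ
  a k = Δ^ k f 0
  add-difference : ∀ x y → y ≡ x + (y - x)
  add-difference = solve 2 (λ x y → y := x :+ (y :- x)) refl
  Δf-series : Δ f m ≡ Σ< D (λ k → ℕ→ℚ (m C k) * a (suc k))
  Δf-series = begin
    Δ f m
      ≡⟨ newton D (Δ f) (degree-suc D f deg) m ⟩
    Σ< D (λ k → ℕ→ℚ (m C k) * a (suc k)) + ℕ→ℚ (m C D) * a (suc D)
      ≡⟨ cong (λ t → Σ< D (λ k → ℕ→ℚ (m C k) * a (suc k)) + ℕ→ℚ (m C D) * t) (deg 0) ⟩
    Σ< D (λ k → ℕ→ℚ (m C k) * a (suc k)) + ℕ→ℚ (m C D) * 0ℚ
      ≡⟨ drop-zero (Σ< D (λ k → ℕ→ℚ (m C k) * a (suc k))) (ℕ→ℚ (m C D)) ⟩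
    Σ< D (λ k → ℕ→ℚ (m C k) * a (suc k))
      ∎
    where
    drop-zero : ∀ s c → s + c * 0ℚ ≡ s
    drop-zero = solve 2 (λ s c → s :+ c :* con 0ℚ := s) refl

Σ<-newton : ∀ D f → DegreeAtMost D f → ∀ m →
  Σ< m f ≡ Σ< (suc D) (λ k → ℕ→ℚ (m C suc k) * Δ^ k f 0)
Σ<-newton D f deg zero =
  sym (trans (Σ<-cong (suc D) (λ k → ℚP.*-zeroˡ (Δ^ k f 0))) (Σ<-0 (suc D)))
Σ<-newton D f deg (suc m) = begin
  Σ< m f + f m
    ≡⟨ cong₂ _+_ (Σ<-newton D f deg m) (newton D f deg m) ⟩
  Σ< (suc D) (λ k → ℕ→ℚ (m C suc k) * a k) + Σ< (suc D) (λ k → ℕ→ℚ (m C k) * a k)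
    ≡⟨ Σ<-+ (suc D) _ _ ⟨
  Σ< (suc D) (λ k → ℕ→ℚ (m C suc k) * a k + ℕ→ℚ (m C k) * a k)
    ≡⟨ Σ<-cong (suc D) pascal ⟩
  Σ< (suc D) (λ k → ℕ→ℚ (suc m C suc k) * a k)
    ∎
  where
  open ≡-Reasoning
  a : ℕ → ℚ
  a k = Δ^ k f 0
  pascal : ∀ k → ℕ→ℚ (m C suc k) * a k + ℕ→ℚ (m C k) * a k ≡ ℕ→ℚ (suc m C suc k) * a k
  pascal k = begin
    ℕ→ℚ (m C suc k) * a k + ℕ→ℚ (m C k) * a k   ≡⟨ ℚP.*-distribʳ-+ (a k) (ℕ→ℚ (m C suc k)) (ℕ→ℚ (m C k)) ⟨
    (ℕ→ℚ (m C suc k) + ℕ→ℚ (m C k)) * a k       ≡⟨ cong (_* a k) (ℚP.+-comm (ℕ→ℚ (m C suc k)) (ℕ→ℚ (m C k))) ⟩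
    (ℕ→ℚ (m C k) + ℕ→ℚ (m C suc k)) * a k       ≡⟨ cong (_* a k) (ℕ→ℚ-pascal m k) ⟨
    ℕ→ℚ (suc m C suc k) * a k                    ∎

-- Iterated differences at 0 as alternating sums

alternatingSum : ℕ → (ℕ → ℚ) → ℚ
alternatingSum k h = Σ< (suc k) (λ j → sgn j * ℕ→ℚ (k C j) * h (k ∸ j))

alternatingSum-Δ : ∀ k h →
  alternatingSum k (Δ h) ≡ alternatingSum k (λ x → h (suc x)) - alternatingSum k h
alternatingSum-Δ k h =
  trans (Σ<-cong (suc k) distribute) (Σ<-- (suc k) (λ j → a j * h (suc (k ∸ j))) (λ j → a j * h (k ∸ j)))
  where
  a : ℕ → ℚ
  a j = sgn j * ℕ→ℚ (k C j)
  distribute : ∀ j → a j * Δ h (k ∸ j) ≡ a j * h (suc (k ∸ j)) - a j * h (k ∸ j)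
  distribute j = trans (ℚP.*-distribˡ-+ (a j) (h (suc (k ∸ j))) (- h (k ∸ j)))
                       (cong (_+_ (a j * h (suc (k ∸ j)))) (sym (ℚP.neg-distribʳ-* (a j) (h (k ∸ j)))))

alternatingSum⁺ : ℕ → (ℕ → ℚ) → ℚ
alternatingSum⁺ k h = Σ< (suc k) (λ j → sgn j * ℕ→ℚ (k C suc j) * h (k ∸ j))

alternatingSum-suc-head : ∀ k h →
  alternatingSum (suc k) h ≡ h (suc k) - (alternatingSum k h + alternatingSum⁺ k h)
alternatingSum-suc-head k h = begin
  alternatingSum (suc k) h
    ≡⟨ Σ<-head (suc k) (λ j → sgn j * ℕ→ℚ (suc k C j) * h (suc k ∸ j)) ⟩
  1ℚ * 1ℚ * h (suc k) + Σ< (suc k) (λ j → sgn (suc j) * ℕ→ℚ (suc k C suc j) * h (k ∸ j))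
    ≡⟨ cong₂ _+_ (ℚP.*-identityˡ (h (suc k))) (Σ<-cong (suc k) pascal-term) ⟩
  h (suc k) + Σ< (suc k) (λ j → - (b j + c j))
    ≡⟨ cong (_+_ (h (suc k))) (Σ<-neg (suc k) (λ j → b j + c j)) ⟩
  h (suc k) - Σ< (suc k) (λ j → b j + c j)
    ≡⟨ cong (_-_ (h (suc k))) (Σ<-+ (suc k) b c) ⟩
  h (suc k) - (alternatingSum k h + alternatingSum⁺ k h)
    ∎
  where
  open ≡-Reasoning
  b c : ℕ → ℚ
  b j = sgn j * ℕ→ℚ (k C j) * h (k ∸ j)
  c j = sgn j * ℕ→ℚ (k C suc j) * h (k ∸ j)
  pascal-term : ∀ j → sgn (suc j) * ℕ→ℚ (suc k C suc j) * h (k ∸ j) ≡ - (b j + c j)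
  pascal-term j = trans (cong (λ t → - sgn j * t * h (k ∸ j)) (ℕ→ℚ-pascal k j))
                        (expand (sgn j) (ℕ→ℚ (k C j)) (ℕ→ℚ (k C suc j)) (h (k ∸ j)))
    where
    expand : ∀ s a b x → - s * (a + b) * x ≡ - (s * a * x + s * b * x)
    expand = solve 4 (λ s a b x → :- s :* (a :+ b) :* x := :- (s :* a :* x :+ s :* b :* x)) refl

alternatingSum-shift-head : ∀ k h →
  alternatingSum k (λ x → h (suc x)) ≡ h (suc k) - alternatingSum⁺ k h
alternatingSum-shift-head k h = begin
  alternatingSum k (λ x → h (suc x))
    ≡⟨ Σ<-head k (λ j → sgn j * ℕ→ℚ (k C j) * h (suc (k ∸ j))) ⟩
  1ℚ * 1ℚ * h (suc k) + Σ< k (λ j → sgn (suc j) * ℕ→ℚ (k C suc j) * h (suc (k ∸ suc j)))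
    ≡⟨ cong₂ _+_ (ℚP.*-identityˡ (h (suc k))) (Σ<-cong-< k shifted-term) ⟩
  h (suc k) + Σ< k (λ j → - c j)
    ≡⟨ cong (_+_ (h (suc k))) (Σ<-neg k c) ⟩
  h (suc k) - Σ< k c
    ≡⟨ cong (_-_ (h (suc k))) (trans (cong (_+_ (Σ< k c)) last-term) (ℚP.+-identityʳ (Σ< k c))) ⟨
  h (suc k) - alternatingSum⁺ k h
    ∎
  where
  open ≡-Reasoning
  c : ℕ → ℚ
  c j = sgn j * ℕ→ℚ (k C suc j) * h (k ∸ j)
  shifted-term : ∀ j → j < k → sgn (suc j) * ℕ→ℚ (k C suc j) * h (suc (k ∸ suc j)) ≡ - c j
  shifted-term j j<k = begin
    sgn (suc j) * ℕ→ℚ (k C suc j) * h (suc (k ∸ suc j))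
      ≡⟨ cong (λ i → - sgn j * ℕ→ℚ (k C suc j) * h i) (sym (ℕP.+-∸-assoc 1 j<k)) ⟩
    - sgn j * ℕ→ℚ (k C suc j) * h (k ∸ j)
      ≡⟨ neg-out (sgn j) (ℕ→ℚ (k C suc j)) (h (k ∸ j)) ⟩
    - c j
      ∎
    where
    neg-out : ∀ s a x → - s * a * x ≡ - (s * a * x)
    neg-out = solve 3 (λ s a x → :- s :* a :* x := :- (s :* a :* x)) refl
  last-term : c k ≡ 0ℚ
  last-term = begin
    sgn k * ℕ→ℚ (k C suc k) * h (k ∸ k)
      ≡⟨ cong (λ t → sgn k * ℕ→ℚ t * h (k ∸ k)) (NC.k>n⇒nCk≡0 {k} {suc k} ℕP.≤-refl) ⟩
    sgn k * 0ℚ * h (k ∸ k)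
      ≡⟨ cong (_* h (k ∸ k)) (ℚP.*-zeroʳ (sgn k)) ⟩
    0ℚ * h (k ∸ k)
      ≡⟨ ℚP.*-zeroˡ (h (k ∸ k)) ⟩
    0ℚ
      ∎

alternatingSum-suc : ∀ k h →
  alternatingSum (suc k) h ≡ alternatingSum k (λ x → h (suc x)) - alternatingSum k h
alternatingSum-suc k h = begin
  alternatingSum (suc k) h                   ≡⟨ alternatingSum-suc-head k h ⟩
  h (suc k) - (B + B⁺)                       ≡⟨ regroup (h (suc k)) B B⁺ ⟩
  (h (suc k) - B⁺) - B                       ≡⟨ cong (_- B) (alternatingSum-shift-head k h) ⟨
  alternatingSum k (λ x → h (suc x)) - B     ∎
  where
  open ≡-Reasoning
  B = alternatingSum k h
  B⁺ = alternatingSum⁺ k h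
  regroup : ∀ x b c → x - (b + c) ≡ (x - c) - b
  regroup = solve 3 (λ x b c → x :- (b :+ c) := (x :- c) :- b) refl

Δ^-at-0 : ∀ k f → Δ^ k f 0 ≡ alternatingSum k f
Δ^-at-0 zero    f = sym (trans (ℚP.+-identityˡ (1ℚ * 1ℚ * f 0)) (ℚP.*-identityˡ (f 0)))
Δ^-at-0 (suc k) f = begin
  Δ^ k (Δ f) 0                                                 ≡⟨ Δ^-at-0 k (Δ f) ⟩
  alternatingSum k (Δ f)                                       ≡⟨ alternatingSum-Δ k f ⟩
  alternatingSum k (λ x → f (suc x)) - alternatingSum k f      ≡⟨ alternatingSum-suc k f ⟨
  alternatingSum (suc k) f                                     ∎
  where open ≡-Reasoning

-- Binomial coefficients modulo m + 1

infix 4 _≡_[mod_]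
_≡_[mod_] : ℤ → ℤ → ℤ → Set
a ≡ b [mod M ] = ∃ λ c → a ≡ b ℤ.+ M ℤ.* c

fallingℤ : ℤ → ℕ → ℤ
fallingℤ y zero    = + 1
fallingℤ y (suc k) = y ℤ.* fallingℤ (ℤ.pred y) k

[k+1]*[m+1]C[k+1]≡[m+1]*mCk : ∀ m k → suc k ℕ.* (suc m C suc k) ≡ suc m ℕ.* (m C k)
[k+1]*[m+1]C[k+1]≡[m+1]*mCk zero    zero    = refl
[k+1]*[m+1]C[k+1]≡[m+1]*mCk zero    (suc k) = ℕP.*-zeroʳ (suc (suc k))
[k+1]*[m+1]C[k+1]≡[m+1]*mCk (suc m) zero    =
  trans (ℕP.*-identityˡ _) (trans (NC.nC1≡n (suc (suc m))) (sym (ℕP.*-identityʳ _)))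
[k+1]*[m+1]C[k+1]≡[m+1]*mCk (suc m) (suc k) = begin
  suc (suc k) ℕ.* (suc n C suc (suc k))
    ≡⟨ cong (suc (suc k) ℕ.*_) (NC.nCk+nC[k+1]≡[n+1]C[k+1] n (suc k)) ⟨
  suc (suc k) ℕ.* (n C suc k ℕ.+ n C suc (suc k))
    ≡⟨ expand (suc k) (n C suc k) (n C suc (suc k)) ⟩
  n C suc k ℕ.+ suc k ℕ.* (suc m C suc k) ℕ.+ suc (suc k) ℕ.* (suc m C suc (suc k))
    ≡⟨ cong₂ (λ u v → n C suc k ℕ.+ u ℕ.+ v)
         ([k+1]*[m+1]C[k+1]≡[m+1]*mCk m k) ([k+1]*[m+1]C[k+1]≡[m+1]*mCk m (suc k)) ⟩
  n C suc k ℕ.+ n ℕ.* (m C k) ℕ.+ n ℕ.* (m C suc k)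
    ≡⟨ collect (n C suc k) n (m C k) (m C suc k) ⟩
  n C suc k ℕ.+ n ℕ.* (m C k ℕ.+ m C suc k)
    ≡⟨ cong (λ u → n C suc k ℕ.+ n ℕ.* u) (NC.nCk+nC[k+1]≡[n+1]C[k+1] m k) ⟩
  suc n ℕ.* (n C suc k)
    ∎
  where
  open ≡-Reasoning
  n = suc m
  expand : ∀ k a b → suc k ℕ.* (a ℕ.+ b) ≡ a ℕ.+ k ℕ.* a ℕ.+ suc k ℕ.* b
  expand = solve-∀ℕ
  collect : ∀ a n x y → a ℕ.+ n ℕ.* x ℕ.+ n ℕ.* y ≡ a ℕ.+ n ℕ.* (x ℕ.+ y)
  collect = solve-∀ℕ

k!*mCk≡fallingℤ : ∀ m k → + (k ! ℕ.* (m C k)) ≡ fallingℤ (+ m) k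
k!*mCk≡fallingℤ m       zero    = refl
k!*mCk≡fallingℤ zero    (suc k) = cong +_ (ℕP.*-zeroʳ (suc k !))
k!*mCk≡fallingℤ (suc m) (suc k) = begin
  + (suc k ! ℕ.* (suc m C suc k))         ≡⟨ cong +_ (reassoc (k !) k (suc m C suc k)) ⟩
  + (k ! ℕ.* (suc k ℕ.* (suc m C suc k))) ≡⟨ cong (λ u → + (k ! ℕ.* u)) ([k+1]*[m+1]C[k+1]≡[m+1]*mCk m k) ⟩
  + (k ! ℕ.* (suc m ℕ.* (m C k)))         ≡⟨ cong +_ (swap (k !) (suc m) (m C k)) ⟩
  + (suc m ℕ.* (k ! ℕ.* (m C k)))         ≡⟨ ℤP.pos-* (suc m) _ ⟩
  + suc m ℤ.* + (k ! ℕ.* (m C k))         ≡⟨ cong (+ suc m ℤ.*_) (k!*mCk≡fallingℤ m k) ⟩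
  fallingℤ (+ suc m) (suc k)              ∎
  where
  open ≡-Reasoning
  reassoc : ∀ f k c → (suc k ℕ.* f) ℕ.* c ≡ f ℕ.* (suc k ℕ.* c)
  reassoc = solve-∀ℕ
  swap : ∀ x y z → x ℕ.* (y ℕ.* z) ≡ y ℕ.* (x ℕ.* z)
  swap = solve-∀ℕ

fallingℤ-+-mod : ∀ M a k → fallingℤ (M ℤ.+ a) k ≡ fallingℤ a k [mod M ]
fallingℤ-+-mod M a zero    = + 0 , sym (trans (cong (ℤ._+_ (+ 1)) (ℤP.*-zeroʳ M)) (ℤP.+-identityʳ (+ 1)))
fallingℤ-+-mod M a (suc k) with fallingℤ-+-mod M (ℤ.pred a) k
... | c , eq = fallingℤ (ℤ.pred a) k ℤ.+ (M ℤ.+ a) ℤ.* c , (begin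
  (M ℤ.+ a) ℤ.* fallingℤ (ℤ.pred (M ℤ.+ a)) k
    ≡⟨ cong (λ u → (M ℤ.+ a) ℤ.* fallingℤ u k) (pred-+ M a) ⟩
  (M ℤ.+ a) ℤ.* fallingℤ (M ℤ.+ ℤ.pred a) k
    ≡⟨ cong ((M ℤ.+ a) ℤ.*_) eq ⟩
  (M ℤ.+ a) ℤ.* (fallingℤ (ℤ.pred a) k ℤ.+ M ℤ.* c)
    ≡⟨ regroup M a (fallingℤ (ℤ.pred a) k) c ⟩
  a ℤ.* fallingℤ (ℤ.pred a) k ℤ.+ M ℤ.* (fallingℤ (ℤ.pred a) k ℤ.+ (M ℤ.+ a) ℤ.* c)
    ∎)
  where
  open ≡-Reasoning
  pred-+ : ∀ M a → ℤ.-1ℤ ℤ.+ (M ℤ.+ a) ≡ M ℤ.+ (ℤ.-1ℤ ℤ.+ a)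
  pred-+ = solve-∀ℤ
  regroup : ∀ M a F c → (M ℤ.+ a) ℤ.* (F ℤ.+ M ℤ.* c) ≡ a ℤ.* F ℤ.+ M ℤ.* (F ℤ.+ (M ℤ.+ a) ℤ.* c)
  regroup = solve-∀ℤ

fallingℤ-neg : ∀ j k → fallingℤ -[1+ j ] k ℤ.* + (j !) ≡ sgnℤ k ℤ.* + ((j ℕ.+ k) !)
fallingℤ-neg j zero    = cong (λ u → + 1 ℤ.* + (u !)) (sym (ℕP.+-identityʳ j))
fallingℤ-neg j (suc k) = begin
  (-[1+ j ] ℤ.* F) ℤ.* + (j !)           ≡⟨ pull-sign (+ suc j) F (+ (j !)) ⟩
  ℤ.- (F ℤ.* (+ suc j ℤ.* + (j !)))      ≡⟨ cong (λ u → ℤ.- (F ℤ.* u)) (ℤP.pos-* (suc j) (j !)) ⟨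
  ℤ.- (F ℤ.* + (suc j !))                ≡⟨ cong ℤ.-_ (fallingℤ-neg (suc j) k) ⟩
  ℤ.- (sgnℤ k ℤ.* + ((suc j ℕ.+ k) !))   ≡⟨ ℤP.neg-distribˡ-* (sgnℤ k) _ ⟩
  sgnℤ (suc k) ℤ.* + ((suc j ℕ.+ k) !)   ≡⟨ cong (λ u → sgnℤ (suc k) ℤ.* + (u !)) (ℕP.+-suc j k) ⟨
  sgnℤ (suc k) ℤ.* + ((j ℕ.+ suc k) !)   ∎
  where
  open ≡-Reasoning
  F = fallingℤ -[1+ suc j ] k
  pull-sign : ∀ a F b → ((ℤ.- a) ℤ.* F) ℤ.* b ≡ ℤ.- (F ℤ.* (a ℤ.* b))
  pull-sign = solve-∀ℤ

-- m ≡ −1 (mod m + 1), so the falling factorial of m agrees with that of −1.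
k!*mCk≡±k!-mod-[m+1] : ∀ m k → + (k ! ℕ.* (m C k)) ≡ sgnℤ k ℤ.* + (k !) [mod + suc m ]
k!*mCk≡±k!-mod-[m+1] m k with fallingℤ-+-mod (+ suc m) -[1+ 0 ] k
... | c , eq = c , (begin
  + (k ! ℕ.* (m C k))                  ≡⟨ k!*mCk≡fallingℤ m k ⟩
  fallingℤ (+ suc m ℤ.+ -[1+ 0 ]) k    ≡⟨ eq ⟩
  fallingℤ -[1+ 0 ] k ℤ.+ + suc m ℤ.* c
    ≡⟨ cong (ℤ._+ (+ suc m ℤ.* c)) (trans (sym (ℤP.*-identityʳ (fallingℤ -[1+ 0 ] k))) (fallingℤ-neg 0 k)) ⟩
  sgnℤ k ℤ.* + (k !) ℤ.+ + suc m ℤ.* c ∎)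
  where open ≡-Reasoning

-- By the hockey-stick identity (1/M) (M C (k + 1)) is the mean of x C k over x < M;
-- the Volkenborn integral of x C k is (-1)^k / (k + 1).
binomialSumError : (M : ℕ) .{{_ : NonZero M}} → ℕ → ℚ
binomialSumError M k = (+ 1 / M) * ℕ→ℚ (M C suc k) - sgn k * (+ 1 / suc k)

1/n*n≡1 : ∀ n .{{_ : NonZero n}} → (+ 1 / n) * ℕ→ℚ n ≡ 1ℚ
1/n*n≡1 (suc m) = ℚP.toℚᵘ-injective (begin
  toℚᵘ ((+ 1 / suc m) * ℕ→ℚ (suc m))              ≈⟨ ℚP.toℚᵘ-homo-* (+ 1 / suc m) (ℕ→ℚ (suc m)) ⟩
  toℚᵘ (+ 1 / suc m) U.* toℚᵘ (ℕ→ℚ (suc m))      ≈⟨ UP.*-cong (ℚP.toℚᵘ-fromℚᵘ (mkℚᵘ (+ 1) m)) (toℚᵘ-ℤ→ℚ (+ suc m)) ⟩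
  mkℚᵘ (+ 1) m U.* mkℚᵘ (+ suc m) 0              ≈⟨ *≡* (cross-multiply m) ⟩
  toℚᵘ 1ℚ                                         ∎)
  where
  open UP.≃-Reasoning
  cross-multiply : ∀ m → (+ 1 ℤ.* + suc m) ℤ.* + 1 ≡ + 1 ℤ.* + (suc m ℕ.* 1)
  cross-multiply m = trans (ℤP.*-identityʳ (+ 1 ℤ.* + suc m))
                           (cong (λ t → + 1 ℤ.* + t) (sym (ℕP.*-identityʳ (suc m))))

binomialSumError*[k+1]! : ∀ M .{{_ : NonZero M}} k →
  ∃ λ c → binomialSumError M k * ℕ→ℚ (suc k !) ≡ ℤ→ℚ (+ M ℤ.* c)
binomialSumError*[k+1]! (suc m) k with k!*mCk≡±k!-mod-[m+1] m k
... | c , congruence = c , (begin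
  (R * X - s * I) * ℕ→ℚ (suc k !)     ≡⟨ cong ((R * X - s * I) *_) (ℕ→ℚ-* (suc k) (k !)) ⟩
  (R * X - s * I) * (Kp * K)          ≡⟨ distribute R X s I Kp K ⟩
  R * (Kp * X) * K - s * (I * Kp) * K ≡⟨ cong₂ (λ u w → R * u * K - s * w * K) absorption (1/n*n≡1 (suc k)) ⟩
  R * (Mq * Y) * K - s * 1ℚ * K       ≡⟨ regroup R Mq Y K s ⟩
  (R * Mq) * (K * Y) - s * K          ≡⟨ cong₂ (λ u w → u * w - s * K) (1/n*n≡1 (suc m)) congruenceℚ ⟩
  1ℚ * (s * K + Mq * ℤ→ℚ c) - s * K   ≡⟨ cancel s K Mq (ℤ→ℚ c) ⟩
  Mq * ℤ→ℚ c                          ≡⟨ ℤ→ℚ-* (+ suc m) c ⟨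
  ℤ→ℚ (+ suc m ℤ.* c)                 ∎)
  where
  open ≡-Reasoning
  R = + 1 / suc m
  X = ℕ→ℚ (suc m C suc k)
  s = sgn k
  I = + 1 / suc k
  Kp = ℕ→ℚ (suc k)
  K = ℕ→ℚ (k !)
  Mq = ℕ→ℚ (suc m)
  Y = ℕ→ℚ (m C k)
  absorption : Kp * X ≡ Mq * Y
  absorption = begin
    Kp * X                            ≡⟨ ℕ→ℚ-* (suc k) (suc m C suc k) ⟨
    ℕ→ℚ (suc k ℕ.* (suc m C suc k))   ≡⟨ cong ℕ→ℚ ([k+1]*[m+1]C[k+1]≡[m+1]*mCk m k) ⟩
    ℕ→ℚ (suc m ℕ.* (m C k))           ≡⟨ ℕ→ℚ-* (suc m) (m C k) ⟩
    Mq * Y                            ∎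
  congruenceℚ : K * Y ≡ s * K + Mq * ℤ→ℚ c
  congruenceℚ = begin
    K * Y                                         ≡⟨ ℕ→ℚ-* (k !) (m C k) ⟨
    ℤ→ℚ (+ (k ! ℕ.* (m C k)))                     ≡⟨ cong ℤ→ℚ congruence ⟩
    ℤ→ℚ (sgnℤ k ℤ.* + (k !) ℤ.+ + suc m ℤ.* c)    ≡⟨ ℤ→ℚ-+ (sgnℤ k ℤ.* + (k !)) (+ suc m ℤ.* c) ⟩
    ℤ→ℚ (sgnℤ k ℤ.* + (k !)) + ℤ→ℚ (+ suc m ℤ.* c)
      ≡⟨ cong₂ _+_ (trans (ℤ→ℚ-* (sgnℤ k) (+ (k !))) (cong (_* K) (sym (sgn≡ℤ→ℚ-sgnℤ k))))
                   (ℤ→ℚ-* (+ suc m) c) ⟩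
    s * K + Mq * ℤ→ℚ c                            ∎
  distribute : ∀ R X s I Kp K → (R * X - s * I) * (Kp * K) ≡ R * (Kp * X) * K - s * (I * Kp) * K
  distribute = solve 6 (λ R X s I Kp K → (R :* X :- s :* I) :* (Kp :* K) := R :* (Kp :* X) :* K :- s :* (I :* Kp) :* K) refl
  regroup : ∀ R Mq Y K s → R * (Mq * Y) * K - s * 1ℚ * K ≡ (R * Mq) * (K * Y) - s * K
  regroup = solve 5 (λ R Mq Y K s → R :* (Mq :* Y) :* K :- s :* con 1ℚ :* K := (R :* Mq) :* (K :* Y) :- s :* K) refl
  cancel : ∀ s K Mq c → 1ℚ * (s * K + Mq * c) - s * K ≡ Mq * c
  cancel = solve 4 (λ s K Mq c → con 1ℚ :* (s :* K :+ Mq :* c) :- s :* K := Mq :* c) refl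

-- p-adic smallness

module _ (p : ℕ) (pp : Prime p) where

  private instance
    p-nonZero : NonZero p
    p-nonZero = prime⇒nonZero pp
    p-nonTrivial : ℕ.NonTrivial p
    p-nonTrivial = prime⇒nonTrivial pp

  p∤1 : ¬ p ∣ 1
  p∤1 p∣1 = ℕ.nonTrivial⇒≢1 (ND.∣1⇒≡1 p∣1)

  p∣m*n⇒p∣m : ∀ {m n} → ¬ p ∣ n → p ∣ m ℕ.* n → p ∣ m
  p∣m*n⇒p∣m {m} {n} p∤n p∣mn with euclidsLemma m n pp p∣mn
  ... | inj₁ p∣m = p∣m
  ... | inj₂ p∣n = ⊥-elim (p∤n p∣n)

  p∤m⇒p∤n⇒p∤m*n : ∀ {m n} → ¬ p ∣ m → ¬ p ∣ n → ¬ p ∣ m ℕ.* n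
  p∤m⇒p∤n⇒p∤m*n p∤m p∤n p∣mn = p∤m (p∣m*n⇒p∣m p∤n p∣mn)

  p^e∣m*n⇒p^e∣m : ∀ e {m n} → ¬ p ∣ n → p ℕ.^ e ∣ m ℕ.* n → p ℕ.^ e ∣ m
  p^e∣m*n⇒p^e∣m zero    {m} p∤n _ = ND.1∣ m
  p^e∣m*n⇒p^e∣m (suc e) {m} {n} p∤n p^[1+e]∣mn
    with p∣m*n⇒p∣m {m} {n} p∤n (ND.∣-trans (ND.m∣m*n (p ℕ.^ e)) p^[1+e]∣mn)
  ... | divides q refl = subst (p ℕ.* p ℕ.^ e ∣_) (ℕP.*-comm p q)
          (ND.*-monoʳ-∣ p (p^e∣m*n⇒p^e∣m e p∤n
            (ND.*-cancelˡ-∣ p (subst (p ℕ.* p ℕ.^ e ∣_) (reassoc q p n) p^[1+e]∣mn))))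
    where
    reassoc : ∀ q p n → q ℕ.* p ℕ.* n ≡ p ℕ.* (q ℕ.* n)
    reassoc = solve-∀ℕ

  lowestTerms-valuation : ∀ e v {a d u z} → Coprime a d → ¬ p ∣ u →
    p ℕ.^ (e ℕ.+ v) ∣ z → a ℕ.* (p ℕ.^ v ℕ.* u) ≡ z ℕ.* d → (p ℕ.^ e ∣ a) × (¬ p ∣ d)
  lowestTerms-valuation e v {a} {d} {u} cop p∤u (divides w refl) eq = p^e∣a , p∤d
    where
    cancelled : a ℕ.* u ≡ w ℕ.* p ℕ.^ e ℕ.* d
    cancelled = ℕP.*-cancelˡ-≡ _ _ (p ℕ.^ v) {{ℕP.m^n≢0 p v}} (begin
      p ℕ.^ v ℕ.* (a ℕ.* u)                   ≡⟨ swap (p ℕ.^ v) a u ⟩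
      a ℕ.* (p ℕ.^ v ℕ.* u)                   ≡⟨ eq ⟩
      w ℕ.* p ℕ.^ (e ℕ.+ v) ℕ.* d             ≡⟨ cong (λ t → w ℕ.* t ℕ.* d) (ℕP.^-distribˡ-+-* p e v) ⟩
      w ℕ.* (p ℕ.^ e ℕ.* p ℕ.^ v) ℕ.* d       ≡⟨ pull-out w (p ℕ.^ e) (p ℕ.^ v) d ⟩
      p ℕ.^ v ℕ.* (w ℕ.* p ℕ.^ e ℕ.* d)       ∎)
      where
      open ≡-Reasoning
      swap : ∀ x a u → x ℕ.* (a ℕ.* u) ≡ a ℕ.* (x ℕ.* u)
      swap = solve-∀ℕ
      pull-out : ∀ w a b d → w ℕ.* (a ℕ.* b) ℕ.* d ≡ b ℕ.* (w ℕ.* a ℕ.* d)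
      pull-out = solve-∀ℕ
    p^e∣a : p ℕ.^ e ∣ a
    p^e∣a = p^e∣m*n⇒p^e∣m e p∤u
              (subst (p ℕ.^ e ∣_) (sym cancelled) (ND.∣m⇒∣m*n d (ND.n∣m*n w)))
    p∤d : ¬ p ∣ d
    p∤d p∣d = ℕ.nonTrivial⇒≢1 (cop (p∣a , p∣d))
      where
      p∣a : p ∣ a
      p∣a = p∣m*n⇒p∣m p∤u (subst (p ∣_) (sym cancelled) (ND.∣n⇒∣m*n (w ℕ.* p ℕ.^ e) p∣d))

  PadicSmallᵘ : ℕ → ℚᵘ → Set
  PadicSmallᵘ e x = p ℕ.^ e ∣ ∣ U.↥ x ∣ × ¬ p ∣ U.↧ₙ x

  PadicSmall⇒PadicSmallᵘ : ∀ e q → PadicSmall p e q → PadicSmallᵘ e (toℚᵘ q)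
  PadicSmall⇒PadicSmallᵘ e (mkℚ _ _ _) small = small

  PadicSmallᵘ⇒PadicSmall : ∀ e x q → x ≃ toℚᵘ q → PadicSmallᵘ e x → PadicSmall p e q
  PadicSmallᵘ⇒PadicSmall e (mkℚᵘ a d) (mkℚ a′ d′ cop) (*≡* eq) (p^e∣a , p∤d) =
    lowestTerms-valuation e 0 (Coprimality.recompute cop) p∤d
      (subst (λ t → p ℕ.^ t ∣ ∣ a ∣) (sym (ℕP.+-identityʳ e)) p^e∣a)
      (begin
        ∣ a′ ∣ ℕ.* (1 ℕ.* suc d)  ≡⟨ cong (∣ a′ ∣ ℕ.*_) (ℕP.*-identityˡ (suc d)) ⟩
        ∣ a′ ∣ ℕ.* suc d          ≡⟨ ℤP.abs-* a′ (+ suc d) ⟨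
        ∣ a′ ℤ.* + suc d ∣        ≡⟨ cong ∣_∣ eq ⟨
        ∣ a ℤ.* + suc d′ ∣        ≡⟨ ℤP.abs-* a (+ suc d′) ⟩
        ∣ a ∣ ℕ.* suc d′          ∎)
    where open ≡-Reasoning

  PadicSmallᵘ-+ : ∀ e x y → PadicSmallᵘ e x → PadicSmallᵘ e y → PadicSmallᵘ e (x U.+ y)
  PadicSmallᵘ-+ e (mkℚᵘ a b) (mkℚᵘ c d) (p^e∣a , p∤b) (p^e∣c , p∤d) =
    ZS.∣⇒∣ᵤ {+ (p ℕ.^ e)} {a ℤ.* + suc d ℤ.+ c ℤ.* + suc b}
      (ZS.∣m∣n⇒∣m+n (ZS.∣m⇒∣m*n {+ (p ℕ.^ e)} {a} (+ suc d) (ZS.∣ᵤ⇒∣ {+ (p ℕ.^ e)} {a} p^e∣a))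
                    (ZS.∣m⇒∣m*n {+ (p ℕ.^ e)} {c} (+ suc b) (ZS.∣ᵤ⇒∣ {+ (p ℕ.^ e)} {c} p^e∣c))) ,
    p∤m⇒p∤n⇒p∤m*n p∤b p∤d

  PadicSmallᵘ-* : ∀ e x y → PadicSmallᵘ e x → PadicSmallᵘ 0 y → PadicSmallᵘ e (x U.* y)
  PadicSmallᵘ-* e (mkℚᵘ a b) (mkℚᵘ c d) (p^e∣a , p∤b) (_ , p∤d) =
    subst (p ℕ.^ e ∣_) (sym (ℤP.abs-* a c)) (ND.∣m⇒∣m*n ∣ c ∣ p^e∣a) ,
    p∤m⇒p∤n⇒p∤m*n p∤b p∤d

  PadicSmallᵘ-neg : ∀ e x → PadicSmallᵘ e x → PadicSmallᵘ e (U.- x)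
  PadicSmallᵘ-neg e (mkℚᵘ a b) (p^e∣a , p∤b) = subst (p ℕ.^ e ∣_) (sym (ℤP.∣-i∣≡∣i∣ a)) p^e∣a , p∤b

  PadicSmall-+ : ∀ e q r → PadicSmall p e q → PadicSmall p e r → PadicSmall p e (q + r)
  PadicSmall-+ e q r q-small r-small =
    PadicSmallᵘ⇒PadicSmall e _ (q + r) (UP.≃-sym (ℚP.toℚᵘ-homo-+ q r))
      (PadicSmallᵘ-+ e (toℚᵘ q) (toℚᵘ r)
        (PadicSmall⇒PadicSmallᵘ e q q-small) (PadicSmall⇒PadicSmallᵘ e r r-small))

  PadicSmall-* : ∀ e q r → PadicSmall p e q → PadicSmall p 0 r → PadicSmall p e (q * r)
  PadicSmall-* e q r q-small r-integral =
    PadicSmallᵘ⇒PadicSmall e _ (q * r) (UP.≃-sym (ℚP.toℚᵘ-homo-* q r))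
      (PadicSmallᵘ-* e (toℚᵘ q) (toℚᵘ r)
        (PadicSmall⇒PadicSmallᵘ e q q-small) (PadicSmall⇒PadicSmallᵘ 0 r r-integral))

  PadicSmall-neg : ∀ e q → PadicSmall p e q → PadicSmall p e (- q)
  PadicSmall-neg e q q-small =
    PadicSmallᵘ⇒PadicSmall e _ (- q) (UP.≃-sym (ℚP.toℚᵘ-homo‿- q))
      (PadicSmallᵘ-neg e (toℚᵘ q) (PadicSmall⇒PadicSmallᵘ e q q-small))

  PadicSmall-- : ∀ e q r → PadicSmall p e q → PadicSmall p e r → PadicSmall p e (q - r)
  PadicSmall-- e q r q-small r-small = PadicSmall-+ e q (- r) q-small (PadicSmall-neg e r r-small)

  PadicSmall-0ℚ : ∀ e → PadicSmall p e 0ℚ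
  PadicSmall-0ℚ e = ND._∣0 (p ℕ.^ e) , p∤1

  PadicSmall-ℤ→ℚ : ∀ z → PadicSmall p 0 (ℤ→ℚ z)
  PadicSmall-ℤ→ℚ z =
    PadicSmallᵘ⇒PadicSmall 0 (mkℚᵘ z 0) (ℤ→ℚ z) (UP.≃-sym (toℚᵘ-ℤ→ℚ z)) (ND.1∣ ∣ z ∣ , p∤1)

  PadicSmall-^ℚ : ∀ q r → PadicSmall p 0 q → PadicSmall p 0 (q ^ℚ r)
  PadicSmall-^ℚ q zero    q-integral = PadicSmall-ℤ→ℚ (+ 1)
  PadicSmall-^ℚ q (suc r) q-integral =
    PadicSmall-* 0 q (q ^ℚ r) q-integral (PadicSmall-^ℚ q r q-integral)

  PadicSmall-Δ^ : ∀ f → (∀ x → PadicSmall p 0 (f x)) → ∀ k x → PadicSmall p 0 (Δ^ k f x)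
  PadicSmall-Δ^ f f-integral zero    x = f-integral x
  PadicSmall-Δ^ f f-integral (suc k) x =
    PadicSmall-Δ^ (Δ f) (λ y → PadicSmall-- 0 (f (suc y)) (f y) (f-integral (suc y)) (f-integral y)) k x

  PadicSmall-cancel : ∀ e v u q z → ¬ p ∣ u → p ℕ.^ (e ℕ.+ v) ∣ ∣ z ∣ →
                      q * ℕ→ℚ (p ℕ.^ v ℕ.* u) ≡ ℤ→ℚ z → PadicSmall p e q
  PadicSmall-cancel e v u q@(mkℚ a d cop) z p∤u p^[e+v]∣z eq =
    lowestTerms-valuation e v (Coprimality.recompute cop) p∤u p^[e+v]∣z cross
    where
    F = p ℕ.^ v ℕ.* u
    eqᵘ : mkℚᵘ a d U.* mkℚᵘ (+ F) 0 ≃ mkℚᵘ z 0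
    eqᵘ = begin
      mkℚᵘ a d U.* mkℚᵘ (+ F) 0    ≈⟨ UP.*-cong (UP.≃-refl {toℚᵘ q}) (toℚᵘ-ℤ→ℚ (+ F)) ⟨
      toℚᵘ q U.* toℚᵘ (ℕ→ℚ F)      ≈⟨ ℚP.toℚᵘ-homo-* q (ℕ→ℚ F) ⟨
      toℚᵘ (q * ℕ→ℚ F)             ≈⟨ ℚP.toℚᵘ-cong eq ⟩
      toℚᵘ (ℤ→ℚ z)                 ≈⟨ toℚᵘ-ℤ→ℚ z ⟩
      mkℚᵘ z 0                     ∎
      where open UP.≃-Reasoning
    cross : ∣ a ∣ ℕ.* F ≡ ∣ z ∣ ℕ.* suc d
    cross = begin
      ∣ a ∣ ℕ.* F                  ≡⟨ ℤP.abs-* a (+ F) ⟨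
      ∣ a ℤ.* + F ∣                ≡⟨ cong ∣_∣ (ℤP.*-identityʳ (a ℤ.* + F)) ⟨
      ∣ (a ℤ.* + F) ℤ.* + 1 ∣      ≡⟨ cong ∣_∣ (UP.drop-*≡* eqᵘ) ⟩
      ∣ z ℤ.* + (suc d ℕ.* 1) ∣    ≡⟨ ℤP.abs-* z (+ (suc d ℕ.* 1)) ⟩
      ∣ z ∣ ℕ.* (suc d ℕ.* 1)      ≡⟨ cong (∣ z ∣ ℕ.*_) (ℕP.*-identityʳ (suc d)) ⟩
      ∣ z ∣ ℕ.* suc d              ∎
      where open ≡-Reasoning

  p-part : ∀ n .{{_ : NonZero n}} → ∃₂ λ v u → n ≡ p ℕ.^ v ℕ.* u × ¬ p ∣ u
  p-part n = split n n ℕP.≤-refl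
    where
    split : ∀ fuel n .{{_ : NonZero n}} → n ≤ fuel → ∃₂ λ v u → n ≡ p ℕ.^ v ℕ.* u × ¬ p ∣ u
    split fuel       zero    {{()}} _
    split zero       (suc n) ()
    split (suc fuel) (suc n) n≤fuel with p ∣? suc n
    ... | no p∤n = 0 , suc n , sym (ℕP.*-identityˡ (suc n)) , p∤n
    ... | yes p∣n@(divides q n≡q*p)
      with split fuel q {{ND.quotient≢0 p∣n}} (ℕP.≤-pred (ℕP.≤-trans (ND.quotient-< p∣n) n≤fuel))
    ...   | v , u , q≡p^v*u , p∤u =
      suc v , u , trans n≡q*p (trans (cong (ℕ._* p) q≡p^v*u) (reassoc (p ℕ.^ v) u p)) , p∤u
      where
      reassoc : ∀ a u p → a ℕ.* u ℕ.* p ≡ p ℕ.* a ℕ.* u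
      reassoc = solve-∀ℕ

  p^m∣p^n : ∀ {m n} → m ≤ n → p ℕ.^ m ∣ p ℕ.^ n
  p^m∣p^n {m} {n} m≤n =
    subst (p ℕ.^ m ∣_) (trans (sym (ℕP.^-distribˡ-+-* p m (n ∸ m))) (cong (p ℕ.^_) (ℕP.m+[n∸m]≡n m≤n)))
      (ND.m∣m*n (p ℕ.^ (n ∸ m)))

  EventuallySmall : ℕ → (ℕ → ℚ) → Set
  EventuallySmall e a = ∃ λ N₀ → ∀ N → N₀ ≤ N → PadicSmall p e (a N)

  EventuallySmall-cong : ∀ e {a b} → (∀ N → a N ≡ b N) → EventuallySmall e a → EventuallySmall e b
  EventuallySmall-cong e a≡b (N₀ , small) = N₀ , λ N N₀≤N → subst (PadicSmall p e) (a≡b N) (small N N₀≤N)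

  EventuallySmall-Σ< : ∀ e n (a : ℕ → ℕ → ℚ) → (∀ k → k < n → EventuallySmall e (λ N → a N k)) →
                       EventuallySmall e (λ N → Σ< n (a N))
  EventuallySmall-Σ< e zero    a small = 0 , λ N _ → PadicSmall-0ℚ e
  EventuallySmall-Σ< e (suc n) a small
    with EventuallySmall-Σ< e n a (λ k k<n → small k (ℕP.m<n⇒m<1+n k<n)) | small n ℕP.≤-refl
  ... | N₁ , init-small | N₂ , last-small = N₁ ⊔ N₂ , λ N N₁⊔N₂≤N →
    PadicSmall-+ e (Σ< n (a N)) (a N n)
      (init-small N (ℕP.m⊔n≤o⇒m≤o N₁ N₂ N₁⊔N₂≤N)) (last-small N (ℕP.m⊔n≤o⇒n≤o N₁ N₂ N₁⊔N₂≤N))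

  EventuallySmall-*-integral : ∀ e a b → EventuallySmall e a → PadicSmall p 0 b →
                               EventuallySmall e (λ N → a N * b)
  EventuallySmall-*-integral e a b (N₀ , small) b-integral =
    N₀ , λ N N₀≤N → PadicSmall-* e (a N) b (small N N₀≤N) b-integral

  binomialSumErrorAt : ℕ → ℕ → ℚ
  binomialSumErrorAt N = binomialSumError (p ℕ.^ N) {{ℕP.m^n≢0 p N}}

  -- v_p(error) ≥ N - v_p((k + 1)!).
  binomialSumError-small : ∀ e k → EventuallySmall e (λ N → binomialSumErrorAt N k)
  binomialSumError-small e k with p-part (suc k !) {{ℕP._!≢0 (suc k)}}
  ... | v , u , [k+1]!≡p^v*u , p∤u = e ℕ.+ v , small
    where
    small : ∀ N → e ℕ.+ v ≤ N → PadicSmall p e (binomialSumErrorAt N k)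
    small N e+v≤N = from-multiple (binomialSumError*[k+1]! (p ℕ.^ N) {{ℕP.m^n≢0 p N}} k)
      where
      from-multiple : (∃ λ c → binomialSumErrorAt N k * ℕ→ℚ (suc k !) ≡ ℤ→ℚ (+ (p ℕ.^ N) ℤ.* c)) →
                      PadicSmall p e (binomialSumErrorAt N k)
      from-multiple (c , error*[k+1]!) =
        PadicSmall-cancel e v u (binomialSumErrorAt N k) (+ (p ℕ.^ N) ℤ.* c) p∤u
          (subst (p ℕ.^ (e ℕ.+ v) ∣_) (sym (ℤP.abs-* (+ (p ℕ.^ N)) c))
            (ND.∣m⇒∣m*n ∣ c ∣ (p^m∣p^n e+v≤N)))
          (subst (λ t → binomialSumErrorAt N k * ℕ→ℚ t ≡ ℤ→ℚ (+ (p ℕ.^ N) ℤ.* c))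
            [k+1]!≡p^v*u error*[k+1]!)

  volkenbornSum-error : ∀ D f → DegreeAtMost D f → ∀ N →
    volkenbornSum p pp f N - Σ< (suc D) (λ k → sgn k * (+ 1 / suc k) * Δ^ k f 0)
      ≡ Σ< (suc D) (λ k → binomialSumErrorAt N k * Δ^ k f 0)
  volkenbornSum-error D f deg N = begin
    R * Σ< M f - L
      ≡⟨ cong (λ t → R * t - L) (Σ<-newton D f deg M) ⟩
    R * Σ< (suc D) (λ k → ℕ→ℚ (M C suc k) * a k) - L
      ≡⟨ cong (_- L) (*-distribˡ-Σ< (suc D) R (λ k → ℕ→ℚ (M C suc k) * a k)) ⟩
    Σ< (suc D) (λ k → R * (ℕ→ℚ (M C suc k) * a k)) - L
      ≡⟨ Σ<-- (suc D) (λ k → R * (ℕ→ℚ (M C suc k) * a k)) (λ k → sgn k * (+ 1 / suc k) * a k) ⟨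
    Σ< (suc D) (λ k → R * (ℕ→ℚ (M C suc k) * a k) - sgn k * (+ 1 / suc k) * a k)
      ≡⟨ Σ<-cong (suc D) (λ k → factor R (ℕ→ℚ (M C suc k)) (a k) (sgn k) (+ 1 / suc k)) ⟩
    Σ< (suc D) (λ k → binomialSumErrorAt N k * a k)
      ∎
    where
    open ≡-Reasoning
    M = p ℕ.^ N
    instance
      M-nonZero : NonZero M
      M-nonZero = ℕP.m^n≢0 p N
    R = + 1 / M
    a : ℕ → ℚ
    a k = Δ^ k f 0
    L = Σ< (suc D) (λ k → sgn k * (+ 1 / suc k) * a k)
    factor : ∀ R X b s I → R * (X * b) - s * I * b ≡ (R * X - s * I) * b
    factor = solve 5 (λ R X b s I → R :* (X :* b) :- s :* I :* b := (R :* X :- s :* I) :* b) refl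

  volkenbornIntegral-newton : ∀ D f → DegreeAtMost D f → (∀ x → PadicSmall p 0 (f x)) →
    VolkenbornIntegral≡ p pp f (Σ< (suc D) (λ k → sgn k * (+ 1 / suc k) * Δ^ k f 0))
  volkenbornIntegral-newton D f deg f-integral e =
    EventuallySmall-cong e (λ N → sym (volkenbornSum-error D f deg N))
      (EventuallySmall-Σ< e (suc D) (λ N k → binomialSumErrorAt N k * Δ^ k f 0)
        (λ k _ → EventuallySmall-*-integral e (λ N → binomialSumErrorAt N k) (Δ^ k f 0)
                   (binomialSumError-small e k) (PadicSmall-Δ^ f f-integral k 0)))

mainTheorem13 : (p : ℕ) → (pp : Prime p) → (n r : ℕ) → 1 ≤ r →
    VolkenbornIntegral≡ p pp (λ x → ℕ→ℚ (x C n) ^ℚ r) (rhs13 n r)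
mainTheorem13 p pp n r _ =
  subst (VolkenbornIntegral≡ p pp f) newton-coefficients
    (volkenbornIntegral-newton p pp (n ℕ.* r) f
      (degree-^ℚ n r (λ x → ℕ→ℚ (x C n)) (degree-C n))
      (λ x → PadicSmall-^ℚ p pp (ℕ→ℚ (x C n)) r (PadicSmall-ℤ→ℚ p pp (+ (x C n)))))
  where
  f : ℕ → ℚ
  f x = ℕ→ℚ (x C n) ^ℚ r
  newton-coefficients : Σ< (suc (n ℕ.* r)) (λ k → sgn k * (+ 1 / suc k) * Δ^ k f 0) ≡ rhs13 n r
  newton-coefficients =
    Σ<-cong (suc (n ℕ.* r)) (λ k → cong (sgn k * (+ 1 / suc k) *_) (Δ^-at-0 k f))
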